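{- Let $m\ge1$ and $W=W^{(m)}_4$. Then (1) $B_1=\{\gamma\in W:\gamma_1\ge1,\ \gamma_2\le m-1,\ \gamma_3-\gamma_1\ge m\}$; and (2) $W\setminus(B_0\cup B_1)$ is the disjoint union $D_1\cup D_2\cup D_3$, where $D_1=\{(0,\gamma_1,\gamma_2,\gamma_2+m):0<\gamma_1\le m<\gamma_2\le\gamma_1+m\}$, $D_2=\{(0,\gamma_1,m,\gamma_3):0\le\gamma_1\le m,\ \gamma_1+m\le\gamma_3\le 2m\}$, $D_3=\{(0,0,\gamma_2,\gamma_3):0\le\gamma_2<m\le\gamma_3\le\gamma_2+m\}$.
   Context: $W^{(m)}_4$ is the set of sequences $\gamma=(\gamma_0,\gamma_1,\gamma_2,\gamma_3)$ of nonnegative integers with $\gamma_0=0$ and $\gamma_i\le\gamma_{i-1}+m$ for $i=1,2,3$. For $\gamma\in W$, let $r=r(\gamma)$ be the least $i\in\{2,3\}$ with $\gamma_i-\gamma_{i-2}\le m$, or $r=4$ if none exists. $A_0$ is the set of $\gamma\in W$ with $\gamma_{r-1}-1\le\gamma_3+m$ and $\gamma_1>0$; for $\gamma\in A_0$, $f_0(\gamma)=(\gamma_0,\dots,\gamma_{r-2},\gamma_r,\dots,\gamma_3,\gamma_{r-1}-1)$, and $B_0=f_0(A_0)$. $A_1=\{(0,\gamma_1,\gamma_2,\gamma_3)\in W:\gamma_2-\gamma_3>m+1\}$, $f_1(0,\gamma_1,\gamma_2,\gamma_3)=(0,\gamma_3+1,\gamma_1-1,\gamma_2-1)$, and $B_1=f_1(A_1)$.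 -}

module Defs where

open import Data.Nat using (ℕ; zero; suc; _+_; _∸_; _≤_; _<_; _≤?_)
open import Data.Vec using (Vec; []; _∷_)
open import Data.Bool using (if_then_else_)
open import Data.Product using (Σ; _×_)
open import Relation.Nullary.Decidable using (⌊_⌋)
open import Relation.Binary.PropositionalEquality using (_≡_)

Seq : Set
Seq = Vec ℕ 4

SeqSet : Set₁
SeqSet = Seq → Set

-- γ_i (indices ≥ 3 map to γ₃; only 0..3 are ever used)
_at_ : Seq → ℕ → ℕ
(a ∷ b ∷ c ∷ d ∷ []) at 0 = a
(a ∷ b ∷ c ∷ d ∷ []) at 1 = b
(a ∷ b ∷ c ∷ d ∷ []) at 2 = c
(a ∷ b ∷ c ∷ d ∷ []) at _ = d

W : ℕ → SeqSet
W m (a ∷ b ∷ c ∷ d ∷ []) = a ≡ 0 × b ≤ a + m × c ≤ b + m × d ≤ c + m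

r : ℕ → Seq → ℕ
r m (a ∷ b ∷ c ∷ d ∷ []) =
  if ⌊ c ≤? a + m ⌋ then 2 else (if ⌊ d ≤? b + m ⌋ then 3 else 4)

-- (γ₀,…,γ_{r-2},γ_r,…,γ₃,γ_{r-1}-1) for a given r ∈ {2,3,4}
f0-at : ℕ → Seq → Seq
f0-at 2 (a ∷ b ∷ c ∷ d ∷ []) = a ∷ c ∷ d ∷ (b ∸ 1) ∷ []
f0-at 3 (a ∷ b ∷ c ∷ d ∷ []) = a ∷ b ∷ d ∷ (c ∸ 1) ∷ []
f0-at _ (a ∷ b ∷ c ∷ d ∷ []) = a ∷ b ∷ c ∷ (d ∸ 1) ∷ []

f0 : ℕ → Seq → Seq
f0 m γ = f0-at (r m γ) γ

A0 : ℕ → SeqSet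
A0 m γ = W m γ × ((γ at (r m γ ∸ 1)) ∸ 1 ≤ (γ at 3) + m) × 0 < γ at 1

B0 : ℕ → SeqSet
B0 m δ = Σ Seq (λ γ → A0 m γ × f0 m γ ≡ δ)

A1 : ℕ → SeqSet
A1 m γ = W m γ × (γ at 3) + (m + 1) < γ at 2

f1 : Seq → Seq
f1 (a ∷ b ∷ c ∷ d ∷ []) = 0 ∷ (d + 1) ∷ (b ∸ 1) ∷ (c ∸ 1) ∷ []

B1 : ℕ → SeqSet
B1 m δ = Σ Seq (λ γ → A1 m γ × f1 γ ≡ δ)

D1 : ℕ → SeqSet
D1 m (a ∷ b ∷ c ∷ d ∷ []) =
  a ≡ 0 × d ≡ c + m × 0 < b × b ≤ m × m < c × c ≤ b + m

D2 : ℕ → SeqSet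
D2 m (a ∷ b ∷ c ∷ d ∷ []) =
  a ≡ 0 × c ≡ m × b ≤ m × b + m ≤ d × d ≤ m + m

D3 : ℕ → SeqSet
D3 m (a ∷ b ∷ c ∷ d ∷ []) =
  a ≡ 0 × b ≡ 0 × c < m × m ≤ d × d ≤ c + m

-- Since f₀ and f₁ are explicit, B₀ and B₁ can be computed: splitting A₀ according to the
-- value of r, every piece of B₀ is cut out of W by linear inequalities, giving
--   B₀ = {δ ∈ W : δ₃ < m, or δ₁ > 0 and (δ₃ < δ₁ + m, or m < δ₂ and δ₃ < δ₂ + m)},
-- and A₁ is sent by f₁ onto the set in part (1). Part (2) is then a case analysis of the
-- inequalities left in W once these conditions fail: δ₁ = 0 gives D₃ or D₂ according to
-- δ₂ < m or δ₂ = m, and δ₁ > 0 forces δ₂ ≥ m, giving D₂ for δ₂ = m and D₁ for δ₂ > m.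
module Submission where

open import Defs
open import Data.Nat using (ℕ; zero; suc; _+_; _∸_; _≤_; _<_; s≤s; z≤n; _≤?_; _<?_)
open import Data.Nat.Properties
open import Data.Product using (_×_; _,_; proj₂)
open import Data.Sum using (_⊎_; inj₁; inj₂)
open import Data.Vec using ([]; _∷_)
open import Relation.Nullary using (¬_; yes; no; contradiction)
open import Relation.Binary using (tri<; tri≈; tri>)
open import Relation.Binary.PropositionalEquality using (_≡_; refl; sym; trans; cong; subst)
open import Function.Bundles using (_⇔_; mk⇔; Equivalence)

B0-cond : ℕ → SeqSet
B0-cond m γ =
  γ at 3 < m
  ⊎ (0 < γ at 1 × γ at 3 < γ at 1 + m)
  ⊎ (0 < γ at 1 × m < γ at 2 × γ at 3 < γ at 2 + m)

B1-cond : ℕ → SeqSet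
B1-cond m γ = 1 ≤ γ at 1 × γ at 2 ≤ m ∸ 1 × γ at 1 + m ≤ γ at 3

D : ℕ → SeqSet
D m γ = D1 m γ ⊎ D2 m γ ⊎ D3 m γ

pred-< : ∀ {n x} → 0 < n → n ≤ x → n ∸ 1 < x
pred-< {suc n} _ n<x = n<x

r≡2 : ∀ {m b c d} → c ≤ m → r m (0 ∷ b ∷ c ∷ d ∷ []) ≡ 2
r≡2 {m} {c = c} c≤m with c ≤? m
... | yes _ = refl
... | no c≰m = contradiction c≤m c≰m

r≡3 : ∀ {m b c d} → ¬ c ≤ m → d ≤ b + m → r m (0 ∷ b ∷ c ∷ d ∷ []) ≡ 3
r≡3 {m} {b} {c} {d} c≰m d≤b+m with c ≤? m | d ≤? b + m
... | yes c≤m | _ = contradiction c≤m c≰m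
... | no _ | yes _ = refl
... | no _ | no d≰b+m = contradiction d≤b+m d≰b+m

r≡4 : ∀ {m b c d} → ¬ c ≤ m → ¬ d ≤ b + m → r m (0 ∷ b ∷ c ∷ d ∷ []) ≡ 4
r≡4 {m} {b} {c} {d} c≰m d≰b+m with c ≤? m | d ≤? b + m
... | yes c≤m | _ = contradiction c≤m c≰m
... | no _ | yes d≤b+m = contradiction d≤b+m d≰b+m
... | no _ | no _ = refl

f0-at-r∈B0 : ∀ {m γ n} → r m γ ≡ n → W m γ → (γ at (n ∸ 1)) ∸ 1 ≤ γ at 3 + m →
             0 < γ at 1 → B0 m (f0-at n γ)
f0-at-r∈B0 {γ = γ} refl w cond pos = γ , (w , cond , pos) , refl

B0⇒W×B0-cond : ∀ {m} γ → B0 m γ → W m γ × B0-cond m γ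
B0⇒W×B0-cond {m} _ ((0 ∷ b ∷ c ∷ d ∷ []) , ((refl , b≤m , c≤b+m , d≤c+m) , cond , 0<b) , refl)
  with c ≤? m | d ≤? b + m
... | yes c≤m | _ = (refl , c≤m , d≤c+m , cond) , inj₁ (pred-< 0<b b≤m)
... | no c≰m | yes d≤b+m =
  (refl , b≤m , d≤b+m , cond) , inj₂ (inj₁ (0<b , pred-< 0<c c≤b+m))
  where 0<c = ≤-trans (s≤s z≤n) (≰⇒> c≰m)
... | no c≰m | no d≰b+m =
  (refl , b≤m , c≤b+m , ≤-trans (m∸n≤m d 1) d≤c+m) ,
  inj₂ (inj₂ (0<b , ≰⇒> c≰m , pred-< 0<d d≤c+m))
  where 0<d = ≤-trans (s≤s z≤n) (≰⇒> d≰b+m)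

B0-via-r≡2 : ∀ {m} δ → W m δ → δ at 3 < m → B0 m δ
B0-via-r≡2 {m} (0 ∷ p ∷ q ∷ s ∷ []) (refl , p≤m , q≤p+m , s≤q+m) s<m =
  f0-at-r∈B0 (r≡2 p≤m) (refl , s<m , ≤-trans p≤m (m≤n+m m (suc s)) , q≤p+m) s≤q+m (s≤s z≤n)

B0-via-r≡3 : ∀ {m} δ → W m δ → 0 < δ at 1 → m ≤ δ at 3 → δ at 3 < δ at 1 + m → B0 m δ
B0-via-r≡3 {m} (0 ∷ p ∷ q ∷ s ∷ []) (refl , p≤m , q≤p+m , s≤q+m) 0<p m≤s s<p+m =
  f0-at-r∈B0 (r≡3 (<⇒≱ (s≤s m≤s)) q≤p+m)
    (refl , p≤m , s<p+m , ≤-trans q≤p+m (+-monoˡ-≤ m (≤-trans p≤m (m≤n⇒m≤1+n m≤s))))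
    s≤q+m 0<p

B0-via-r≡4 : ∀ {m} δ → W m δ → 0 < δ at 1 → m < δ at 2 → δ at 1 + m ≤ δ at 3 →
             δ at 3 < δ at 2 + m → B0 m δ
B0-via-r≡4 {m} (0 ∷ p ∷ q ∷ s ∷ []) (refl , p≤m , q≤p+m , _) 0<p m<q p+m≤s s<q+m =
  f0-at-r∈B0 (r≡4 (<⇒≱ m<q) (<⇒≱ (s≤s p+m≤s)))
    (refl , p≤m , q≤p+m , s<q+m) (m≤n⇒m≤1+n (m≤m+n s m)) 0<p

W×B0-cond⇒B0 : ∀ {m} δ → W m δ × B0-cond m δ → B0 m δ
W×B0-cond⇒B0 δ (w , inj₁ s<m) = B0-via-r≡2 δ w s<m
W×B0-cond⇒B0 {m} δ (w , inj₂ (inj₁ (0<p , s<p+m))) with δ at 3 <? m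
... | yes s<m = B0-via-r≡2 δ w s<m
... | no s≮m = B0-via-r≡3 δ w 0<p (≮⇒≥ s≮m) s<p+m
W×B0-cond⇒B0 {m} δ (w , inj₂ (inj₂ (0<p , m<q , s<q+m))) with δ at 3 <? δ at 1 + m
... | yes s<p+m = W×B0-cond⇒B0 δ (w , inj₂ (inj₁ (0<p , s<p+m)))
... | no s≮p+m = B0-via-r≡4 δ w 0<p m<q (≮⇒≥ s≮p+m) s<q+m

B0⇔W×B0-cond : ∀ {m} γ → B0 m γ ⇔ (W m γ × B0-cond m γ)
B0⇔W×B0-cond γ = mk⇔ (B0⇒W×B0-cond γ) (W×B0-cond⇒B0 γ)

x+1+m≡x+[m+1] : ∀ x m → x + 1 + m ≡ x + (m + 1)
x+1+m≡x+[m+1] x m = trans (+-assoc x 1 m) (cong (x +_) (+-comm 1 m))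

B1⇔W×B1-cond : ∀ {m} → 1 ≤ m → ∀ γ → B1 m γ ⇔ (W m γ × B1-cond m γ)
B1⇔W×B1-cond {suc k} _ γ = mk⇔ (to γ) (from γ)
  where
  m = suc k
  to : ∀ γ → B1 m γ → W m γ × B1-cond m γ
  to _ ((0 ∷ zero ∷ c ∷ d ∷ []) , ((refl , _ , c≤m , _) , d+m+1<c) , refl) =
    contradiction c≤m (<⇒≱ (≤-<-trans (≤-trans (m≤m+n m 1) (m≤n+m (m + 1) d)) d+m+1<c))
  to _ ((0 ∷ suc b ∷ zero ∷ d ∷ []) , (_ , ()) , refl)
  to _ ((0 ∷ suc b ∷ suc c ∷ d ∷ []) , ((refl , s≤s b≤k , s≤s c≤b+m , _) , s≤s d+m+1≤c) , refl) =
    (refl , ≤-trans (+-cancelʳ-≤ m (d + 1) b (≤-trans d+1+m≤c c≤b+m)) (m≤n⇒m≤1+n b≤k) ,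
            m≤n⇒m≤o+n (d + 1) (m≤n⇒m≤1+n b≤k) , c≤b+m) ,
    m≤n+m 1 d , b≤k , d+1+m≤c
    where
    d+1+m≤c : d + 1 + m ≤ c
    d+1+m≤c = subst (_≤ c) (sym (x+1+m≡x+[m+1] d m)) d+m+1≤c
  from : ∀ γ → W m γ × B1-cond m γ → B1 m γ
  from (0 ∷ suc p ∷ q ∷ s ∷ []) ((refl , p<m , _ , s≤q+m) , _ , q≤k , p+1+m≤s) =
    (0 ∷ suc q ∷ suc s ∷ p ∷ []) ,
    ((refl , s≤s q≤k , s≤s s≤q+m , m≤n⇒m≤o+n (suc s) (<⇒≤ p<m)) ,
     s≤s (subst (_≤ s) (trans (cong (_+ m) (+-comm 1 p)) (x+1+m≡x+[m+1] p m)) p+1+m≤s)) ,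
    cong (λ x → 0 ∷ x ∷ q ∷ s ∷ []) (+-comm p 1)

D⇒W : ∀ {m} γ → D m γ → W m γ
D⇒W (0 ∷ b ∷ c ∷ d ∷ []) (inj₁ (refl , refl , _ , b≤m , _ , c≤b+m)) = refl , b≤m , c≤b+m , ≤-refl
D⇒W {m} (0 ∷ b ∷ c ∷ d ∷ []) (inj₂ (inj₁ (refl , refl , b≤m , _ , d≤m+m))) =
  refl , b≤m , m≤n+m m b , d≤m+m
D⇒W (0 ∷ b ∷ c ∷ d ∷ []) (inj₂ (inj₂ (refl , refl , c<m , _ , d≤c+m))) =
  refl , z≤n , <⇒≤ c<m , d≤c+m

D⇒¬B0-cond : ∀ {m} γ → D m γ → ¬ B0-cond m γ
D⇒¬B0-cond {m} (0 ∷ b ∷ c ∷ d ∷ []) (inj₁ (refl , refl , _ , b≤m , m<c , _)) = λ where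
  (inj₁ c+m<m) → <⇒≱ c+m<m (m≤n+m m c)
  (inj₂ (inj₁ (_ , c+m<b+m))) → <⇒≱ c+m<b+m (+-monoˡ-≤ m (≤-trans b≤m (<⇒≤ m<c)))
  (inj₂ (inj₂ (_ , _ , c+m<c+m))) → <-irrefl refl c+m<c+m
D⇒¬B0-cond {m} (0 ∷ b ∷ c ∷ d ∷ []) (inj₂ (inj₁ (refl , refl , _ , b+m≤d , _))) = λ where
  (inj₁ d<m) → <⇒≱ d<m (≤-trans (m≤n+m m b) b+m≤d)
  (inj₂ (inj₁ (_ , d<b+m))) → <⇒≱ d<b+m b+m≤d
  (inj₂ (inj₂ (_ , m<m , _))) → <-irrefl refl m<m
D⇒¬B0-cond (0 ∷ b ∷ c ∷ d ∷ []) (inj₂ (inj₂ (refl , refl , _ , m≤d , _))) = λ where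
  (inj₁ d<m) → <⇒≱ d<m m≤d
  (inj₂ (inj₁ (() , _)))
  (inj₂ (inj₂ (() , _)))

D⇒¬B1-cond : ∀ {m} → 1 ≤ m → ∀ γ → D m γ → ¬ B1-cond m γ
D⇒¬B1-cond (s≤s z≤n) (0 ∷ b ∷ c ∷ d ∷ []) (inj₁ (refl , refl , _ , _ , m<c , _)) (_ , c≤k , _) =
  <⇒≱ m<c (m≤n⇒m≤1+n c≤k)
D⇒¬B1-cond (s≤s z≤n) (0 ∷ b ∷ c ∷ d ∷ []) (inj₂ (inj₁ (refl , refl , _))) (_ , m≤k , _) =
  1+n≰n m≤k
D⇒¬B1-cond _ (0 ∷ b ∷ c ∷ d ∷ []) (inj₂ (inj₂ (refl , refl , _))) (() , _)

W∖conds⇒D : ∀ {m} → 1 ≤ m → ∀ γ → W m γ → ¬ B0-cond m γ → ¬ B1-cond m γ → D m γ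
W∖conds⇒D {m} _ (0 ∷ zero ∷ q ∷ s ∷ []) (refl , _ , q≤m , s≤q+m) ∉B0 _ with s <? m | q <? m
... | yes s<m | _ = contradiction (inj₁ s<m) ∉B0
... | no s≮m | yes q<m = inj₂ (inj₂ (refl , refl , q<m , ≮⇒≥ s≮m , s≤q+m))
... | no s≮m | no q≮m =
  inj₂ (inj₁ (refl , q≡m , z≤n , ≮⇒≥ s≮m , subst (λ x → s ≤ x + m) q≡m s≤q+m))
  where q≡m = ≤-antisym q≤m (≮⇒≥ q≮m)
W∖conds⇒D {m} (s≤s z≤n) (0 ∷ suc p ∷ q ∷ s ∷ []) (refl , p<m , q≤p+m , s≤q+m) ∉B0 ∉B1
  with s <? suc p + m
... | yes s<p+m = contradiction (inj₂ (inj₁ (s≤s z≤n , s<p+m))) ∉B0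
... | no s≮p+m with <-cmp q m
...   | tri< q<m _ _ = contradiction (s≤s z≤n , ≤-pred q<m , ≮⇒≥ s≮p+m) ∉B1
...   | tri≈ _ q≡m _ =
  inj₂ (inj₁ (refl , q≡m , p<m , ≮⇒≥ s≮p+m , subst (λ x → s ≤ x + m) q≡m s≤q+m))
...   | tri> _ _ m<q with s <? q + m
...     | yes s<q+m = contradiction (inj₂ (inj₂ (s≤s z≤n , m<q , s<q+m))) ∉B0
...     | no s≮q+m = inj₁ (refl , ≤-antisym s≤q+m (≮⇒≥ s≮q+m) , s≤s z≤n , p<m , m<q , q≤p+m)

W∖[B0∪B1]⇔D : ∀ {m} → 1 ≤ m → ∀ γ → (W m γ × ¬ (B0 m γ ⊎ B1 m γ)) ⇔ D m γ
W∖[B0∪B1]⇔D {m} 1≤m γ = mk⇔ into-D out-of-B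
  where
  open Equivalence (B0⇔W×B0-cond γ) renaming (to to B0⇒; from to ⇒B0)
  open Equivalence (B1⇔W×B1-cond 1≤m γ) renaming (to to B1⇒; from to ⇒B1)
  into-D : W m γ × ¬ (B0 m γ ⊎ B1 m γ) → D m γ
  into-D (w , ∉B) = W∖conds⇒D 1≤m γ w
    (λ b0 → ∉B (inj₁ (⇒B0 (w , b0))))
    (λ b1 → ∉B (inj₂ (⇒B1 (w , b1))))
  out-of-B : D m γ → W m γ × ¬ (B0 m γ ⊎ B1 m γ)
  out-of-B d = D⇒W γ d , λ where
    (inj₁ b0) → D⇒¬B0-cond γ d (proj₂ (B0⇒ b0))
    (inj₂ b1) → D⇒¬B1-cond 1≤m γ d (proj₂ (B1⇒ b1))

D1∩D2≡∅ : ∀ {m} γ → ¬ (D1 m γ × D2 m γ)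
D1∩D2≡∅ (_ ∷ _ ∷ _ ∷ _ ∷ []) ((_ , _ , _ , _ , m<c , _) , (_ , refl , _)) = <-irrefl refl m<c

D1∩D3≡∅ : ∀ {m} γ → ¬ (D1 m γ × D3 m γ)
D1∩D3≡∅ (_ ∷ _ ∷ _ ∷ _ ∷ []) ((_ , _ , () , _) , (_ , refl , _))

D2∩D3≡∅ : ∀ {m} γ → ¬ (D2 m γ × D3 m γ)
D2∩D3≡∅ (_ ∷ _ ∷ _ ∷ _ ∷ []) ((_ , refl , _) , (_ , _ , m<m , _)) = <-irrefl refl m<m

lemma4p5 : (m : ℕ) → 1 ≤ m →
    ((γ : Seq) → B1 m γ ⇔ (W m γ × 1 ≤ γ at 1 × γ at 2 ≤ m ∸ 1 × (γ at 1) + m ≤ γ at 3))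
    × ((γ : Seq) → (W m γ × ¬ (B0 m γ ⊎ B1 m γ)) ⇔ (D1 m γ ⊎ D2 m γ ⊎ D3 m γ))
    × ((γ : Seq) → ¬ (D1 m γ × D2 m γ))
    × ((γ : Seq) → ¬ (D1 m γ × D3 m γ))
    × ((γ : Seq) → ¬ (D2 m γ × D3 m γ))
lemma4p5 m 1≤m =
  B1⇔W×B1-cond 1≤m , W∖[B0∪B1]⇔D 1≤m , D1∩D2≡∅ , D1∩D3≡∅ , D2∩D3≡∅
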